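{- Let $H$ be a connected graph containing at least one edge, let $v\in V_H$, and let $k\geqslant 3$. Let $G_1$ be the graph obtained by identifying $v$ with a vertex of the cycle $C_k$, and let $G_2$ be the graph obtained by identifying $v$ with a vertex of minimum degree in the lollipop $L_{k,3}$. Then $W(G_1)\leqslant W(G_2)$, with equality if and only if $k=3$.
   Context: $W$ denotes the Wiener index (sum of distances over all unordered vertex pairs). $C_k$ is the cycle on $k$ vertices; the lollipop $L_{k,3}$ is obtained by identifying a vertex of $C_3$ with an end-vertex of the path on $k-2$ vertices (so $L_{3,3}=C_3$). -}

module Defs where

open import Data.Nat using (ℕ; zero; suc; _+_; _∸_; _≤_; _<ᵇ_; _≡ᵇ_; _≤ᵇ_; pred)
open import Data.Bool using (Bool; true; false; _∨_; _∧_; if_then_else_)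
open import Data.Fin using (Fin; toℕ; splitAt; punchIn; _≟_)
open import Data.Sum using (_⊎_; inj₁; inj₂)
open import Data.List using (List; []; _∷_; map; allFin; filter; length)
open import Data.Nat.ListAction using (sum)
open import Data.Bool.ListAction using (any)
open import Data.Product using (Σ; _×_; ∃; ∃-syntax)
open import Relation.Nullary.Decidable using (⌊_⌋)
open import Relation.Binary.PropositionalEquality using (_≡_)

-- A (loopless, undirected) graph on vertex set Fin n is given by a Boolean
-- adjacency function; simplicity is imposed as a predicate.
Adj : ℕ → Set
Adj n = Fin n → Fin n → Bool

IsSimple : ∀ {n} → Adj n → Set
IsSimple {n} G = (∀ (u w : Fin n) → G u w ≡ G w u) × (∀ (u : Fin n) → G u u ≡ false)

HasEdge : ∀ {n} → Adj n → Set
HasEdge {n} G = ∃[ u ] ∃[ w ] (G u w ≡ true)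

data Walk {n} (G : Adj n) : Fin n → Fin n → Set where
  here : ∀ {u} → Walk G u u
  step : ∀ {u x w} → G u x ≡ true → Walk G x w → Walk G u w

Connected : ∀ {n} → Adj n → Set
Connected {n} G = ∀ (u w : Fin n) → Walk G u w

reach : ∀ {n} → Adj n → ℕ → Fin n → Fin n → Bool
reach G zero    u w = ⌊ u ≟ w ⌋
reach G (suc k) u w = reach G k u w ∨ any (λ x → reach G k u x ∧ G x w) (allFin _)

-- least k in [k0, k0+fuel) with reach k u w (returns k0+fuel if none)
distAux : ∀ {n} → Adj n → Fin n → Fin n → ℕ → ℕ → ℕ
distAux G u w k zero       = k
distAux G u w k (suc fuel) = if reach G k u w then k else distAux G u w (suc k) fuel

-- distance = length of a shortest walk (= shortest path); in a connected graph
-- on n vertices it is < n, so searching k = 0 .. n-1 suffices.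
dist : ∀ {n} → Adj n → Fin n → Fin n → ℕ
dist {n} G u w = distAux G u w 0 n

W : ∀ {n} → Adj n → ℕ
W {n} G = sum (map (λ u → sum (map (λ w → if toℕ u <ᵇ toℕ w then dist G u w else 0) (allFin n))) (allFin n))

degree : ∀ {n} → Adj n → Fin n → ℕ
degree {n} G u = length (filter (λ w → G u w Data.Bool.≟ true) (allFin n))
  where import Data.Bool

IsMinDegree : ∀ {n} → Adj n → Fin n → Set
IsMinDegree {n} G u = ∀ (w : Fin n) → degree G u ≤ degree G w

skip : ∀ {m} → Fin m → Fin (pred m) → Fin m
skip {suc m} u j = punchIn u j

-- glue H v K u: disjoint union of H and K with v ∈ H identified with u ∈ K.
-- Vertices: Fin n (those of H, v playing the role of u) followed by
-- the pred m vertices of K other than u.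
glue : ∀ {n m} → Adj n → Fin n → Adj m → Fin m → Adj (n + pred m)
glue {n} H v K u x y with splitAt n x | splitAt n y
... | inj₁ i | inj₁ j = H i j
... | inj₁ i | inj₂ b = ⌊ i ≟ v ⌋ ∧ K u (skip u b)
... | inj₂ a | inj₁ j = ⌊ j ≟ v ⌋ ∧ K (skip u a) u
... | inj₂ a | inj₂ b = K (skip u a) (skip u b)

cycleEdge : (k : ℕ) → ℕ → ℕ → Bool
cycleEdge k i j = (suc i ≡ᵇ j) ∨ ((suc i ≡ᵇ k) ∧ (j ≡ᵇ 0))

cycle : (k : ℕ) → Adj k
cycle k x y = cycleEdge k (toℕ x) (toℕ y) ∨ cycleEdge k (toℕ y) (toℕ x)

-- lollipop L_{k,3} on Fin k: triangle 0,1,2 and path 2 - 3 - ... - (k-1)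
-- (path on k-2 vertices with end vertex 2 identified with a triangle vertex)
lolliEdge : ℕ → ℕ → Bool
lolliEdge i j = ((i ≡ᵇ 0) ∧ (j ≡ᵇ 1)) ∨ ((i ≡ᵇ 0) ∧ (j ≡ᵇ 2)) ∨ ((i ≡ᵇ 1) ∧ (j ≡ᵇ 2))
              ∨ ((2 ≤ᵇ i) ∧ (suc i ≡ᵇ j))

lollipop : (k : ℕ) → Adj k
lollipop k x y = lolliEdge (toℕ x) (toℕ y) ∨ lolliEdge (toℕ y) (toℕ x)

-- Both graphs are H with a graph K on k vertices glued at v: K = C_k, or K = L_{k,3} glued at its pendant vertex.
-- Paths between vertices of H never enter K, so W splits into the pairs inside H (the same for both graphs), the
-- rows d(i, ·) from each vertex i of H to the new vertices, each entry being d(i, v) plus a distance inside K, and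
-- the pairs inside K. For k = 3 both K are triangles, and the gluing vertex does not matter. For k ≥ 4 the cycle
-- distances are bounded above by explicit walks and the lollipop distances below by potentials. Listed in a
-- suitable order, the distances from the pendant vertex of L_{k,3} dominate those from any vertex of C_k termwise,
-- strictly in the last term (k − 2 against 1); so every row grows, the row of a neighbour of v strictly, and a
-- row-by-row comparison shows that the pairwise distances inside K grow too.

module Submission where

open import Defs
open import Data.Nat using (ℕ; zero; suc; _+_; _∸_; _≤_; _<_; _<ᵇ_; _≡ᵇ_; z≤n; s≤s; _⊓_; _⊔_; ∣_-_∣)
open import Data.Nat.Properties hiding (_≟_; ≟-diag)
open import Data.Nat.Tactic.RingSolver using (solve-∀)
import Data.Nat.ListAction as ListAction
open import Data.Bool using (Bool; true; false; _∨_; _∧_; T; if_then_else_)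
import Data.Bool as Bool
open import Data.Bool.Properties using (∨-zeroʳ; ∨-comm)
open import Data.Bool.ListAction using (any)
open import Data.Fin using (Fin; zero; suc; toℕ; splitAt; punchIn; punchOut; fromℕ; fromℕ<; _≟_; _↑ˡ_; _↑ʳ_)
open import Data.Fin.Properties
  using (toℕ<n; toℕ-injective; toℕ-fromℕ; toℕ-fromℕ<; toℕ-↑ˡ; toℕ-↑ʳ; splitAt-↑ˡ; splitAt-↑ʳ; splitAt⁻¹-↑ˡ; splitAt⁻¹-↑ʳ;
         ↑ˡ-injective; ↑ʳ-injective; punchIn-mono-≤; punchIn-cancel-≤; punchIn-injective; punchIn-punchOut; punchInᵢ≢i)
open import Data.List using (List; []; _∷_; map; allFin; tabulate; filter; length)
open import Data.List.Membership.Propositional using (_∈_)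
open import Data.List.Membership.Propositional.Properties using (∈-allFin)
open import Data.List.Relation.Unary.Any using (here; there)
open import Algebra.Properties.CommutativeMonoid.Sum +-0-commutativeMonoid
  using (sum; sum-syntax; sum-cong-≗; ∑-distrib-+; sum-remove; sum-replicate-zero)
open import Data.Sum using (_⊎_; inj₁; inj₂; [_,_])
open import Data.Product using (_×_; _,_; ∃-syntax; proj₁; proj₂)
open import Function using (_∘_; id; const)
open import Function.Bundles using (_⇔_; mk⇔)
open import Relation.Nullary using (¬_; contradiction; yes; no)
open import Relation.Nullary.Decidable using (⌊_⌋)
open import Relation.Nullary.Reflects using (det; of; fromEquivalence)
open import Relation.Binary.Definitions using (tri<; tri≈; tri>)
open import Relation.Binary.PropositionalEquality hiding ([_])

∨-introˡ : ∀ {a} b → a ≡ true → a ∨ b ≡ true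
∨-introˡ b refl = refl

∨-introʳ : ∀ a {b} → b ≡ true → a ∨ b ≡ true
∨-introʳ a refl = ∨-zeroʳ a

∨-elim : ∀ a {b} → a ∨ b ≡ true → a ≡ true ⊎ b ≡ true
∨-elim true  _ = inj₁ refl
∨-elim false e = inj₂ e

∧-elimˡ : ∀ a {b} → a ∧ b ≡ true → a ≡ true
∧-elimˡ true _ = refl

∧-elimʳ : ∀ a {b} → a ∧ b ≡ true → b ≡ true
∧-elimʳ true e = e

∧-intro : ∀ {a b} → a ≡ true → b ≡ true → a ∧ b ≡ true
∧-intro refl refl = refl

any-elim : ∀ {A : Set} (p : A → Bool) xs → any p xs ≡ true → ∃[ x ] p x ≡ true
any-elim p (x ∷ xs) e with ∨-elim (p x) e
... | inj₁ px = x , px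
... | inj₂ pxs = any-elim p xs pxs

any-intro : ∀ {A : Set} (p : A → Bool) {x} xs → x ∈ xs → p x ≡ true → any p xs ≡ true
any-intro p (y ∷ xs) (here refl) e = ∨-introˡ (any p xs) e
any-intro p (y ∷ xs) (there x∈xs) e = ∨-introʳ (p y) (any-intro p xs x∈xs e)

⌊≟⌋-refl : ∀ {n} (x : Fin n) → ⌊ x ≟ x ⌋ ≡ true
⌊≟⌋-refl x = cong ⌊_⌋ (≡-≟-identity _≟_ {x} refl)

≟-true⇒≡ : ∀ {n} {x y : Fin n} → ⌊ x ≟ y ⌋ ≡ true → x ≡ y
≟-true⇒≡ {x = x} {y} e with x ≟ y
... | yes x≡y = x≡y

≡ᵇ-refl : ∀ a → (a ≡ᵇ a) ≡ true
≡ᵇ-refl zero = refl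
≡ᵇ-refl (suc a) = ≡ᵇ-refl a

≡ᵇ-true⇒≡ : ∀ {a b} → (a ≡ᵇ b) ≡ true → a ≡ b
≡ᵇ-true⇒≡ {a} {b} e = ≡ᵇ⇒≡ a b (subst T (sym e) _)

<ᵇ-true : ∀ {x y} → x < y → (x <ᵇ y) ≡ true
<ᵇ-true {x} {y} x<y = det (<ᵇ-reflects-< x y) (of x<y)

<ᵇ-false : ∀ {x y} → ¬ x < y → (x <ᵇ y) ≡ false
<ᵇ-false {x} {y} x≮y = det (<ᵇ-reflects-< x y) (of x≮y)

-- Bounded walks and graph distance

data Reach {n} (G : Adj n) : ℕ → Fin n → Fin n → Set where
  []   : ∀ {L x} → Reach G L x x
  _∷ʳ_ : ∀ {L x y z} → Reach G L x y → G y z ≡ true → Reach G (suc L) x z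

Lipschitz : ∀ {n} → Adj n → (Fin n → ℕ) → Set
Lipschitz {n} G h = ∀ (x y : Fin n) → G x y ≡ true → h y ≤ suc (h x)

WeakHom : ∀ {n n′} → Adj n → Adj n′ → (Fin n → Fin n′) → Set
WeakHom {n} A B f = ∀ (x y : Fin n) → A x y ≡ true → f x ≡ f y ⊎ B (f x) (f y) ≡ true

Lipschitz-∘ : ∀ {n n′} {A : Adj n} {B : Adj n′} {f h} → WeakHom A B f → Lipschitz B h → Lipschitz A (h ∘ f)
Lipschitz-∘ {f = f} {h} hom lip x y e with hom x y e
... | inj₁ fx≡fy = subst (λ z → h z ≤ suc (h (f x))) fx≡fy (n≤1+n _)
... | inj₂ e′ = lip _ _ e′

o≤1+n⇒m∸n≤1+m∸o : ∀ m n o → o ≤ suc n → m ∸ n ≤ suc (m ∸ o)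
o≤1+n⇒m∸n≤1+m∸o m n zero _ = ≤-trans (m∸n≤m m n) (n≤1+n m)
o≤1+n⇒m∸n≤1+m∸o zero n (suc o) _ rewrite 0∸n≡0 n = z≤n
o≤1+n⇒m∸n≤1+m∸o (suc m) zero (suc o) (s≤s o≤0) rewrite n≤0⇒n≡0 o≤0 = ≤-refl
o≤1+n⇒m∸n≤1+m∸o (suc m) (suc n) (suc o) (s≤s o≤1+n) = o≤1+n⇒m∸n≤1+m∸o m n o o≤1+n

Lipschitz-∸ : ∀ {n} {G : Adj n} {h} → (∀ x y → G x y ≡ G y x) → Lipschitz G h → ∀ M → Lipschitz G (λ x → M ∸ h x)
Lipschitz-∸ {h = h} G-sym lip M x y e = o≤1+n⇒m∸n≤1+m∸o M (h y) (h x) (lip y x (trans (G-sym y x) e))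

module _ {n} {G : Adj n} where

  Reach-weaken : ∀ {L L′ x y} → L ≤ L′ → Reach G L x y → Reach G L′ x y
  Reach-weaken _ [] = []
  Reach-weaken (s≤s L≤L′) (r ∷ʳ e) = Reach-weaken L≤L′ r ∷ʳ e

  _++_ : ∀ {L₁ L₂ x y z} → Reach G L₁ x y → Reach G L₂ y z → Reach G (L₁ + L₂) x z
  _++_ {L₁} {L₂} r [] = Reach-weaken (m≤m+n L₁ L₂) r
  _++_ {L₁} {suc L₂} r (r′ ∷ʳ e) rewrite +-suc L₁ L₂ = (r ++ r′) ∷ʳ e

  Reach-reverse : (∀ x y → G x y ≡ G y x) → ∀ {L x y} → Reach G L x y → Reach G L y x
  Reach-reverse sym-G [] = []
  Reach-reverse sym-G (_∷ʳ_ {y = y} {z = z} r e) =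
    ([] ∷ʳ trans (sym-G z y) e) ++ Reach-reverse sym-G r

  Reach-⊓ : ∀ {a b x y} → Reach G a x y → Reach G b x y → Reach G (a ⊓ b) x y
  Reach-⊓ {a} {b} ra rb with ≤-total a b
  ... | inj₁ a≤b rewrite m≤n⇒m⊓n≡m a≤b = ra
  ... | inj₂ b≤a rewrite m≥n⇒m⊓n≡n b≤a = rb

  Reach-0⇒≡ : ∀ {x y} → Reach G 0 x y → x ≡ y
  Reach-0⇒≡ [] = refl

  Lipschitz-Reach : ∀ {h} → Lipschitz G h → ∀ {L x y} → Reach G L x y → h y ≤ L + h x
  Lipschitz-Reach {h} lip {L} {x} [] = m≤n+m (h x) L
  Lipschitz-Reach lip (_∷ʳ_ {y = y} {z = z} r e) = ≤-trans (lip y z e) (s≤s (Lipschitz-Reach lip r))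

  reach⇒Reach : ∀ L x y → reach G L x y ≡ true → Reach G L x y
  reach⇒Reach zero x y e with ≟-true⇒≡ {x = x} e
  ... | refl = []
  reach⇒Reach (suc L) x y e with ∨-elim (reach G L x y) e
  ... | inj₁ r = Reach-weaken (n≤1+n L) (reach⇒Reach L x y r)
  ... | inj₂ a with any-elim (λ z → reach G L x z ∧ G z y) (allFin n) a
  ...   | z , p = reach⇒Reach L x z (∧-elimˡ (reach G L x z) p) ∷ʳ ∧-elimʳ (reach G L x z) p

  Reach⇒reach : ∀ {L x y} → Reach G L x y → reach G L x y ≡ true
  Reach⇒reach {zero} {x} [] = ⌊≟⌋-refl x
  Reach⇒reach {suc L} [] = ∨-introˡ _ (Reach⇒reach {L} [])
  Reach⇒reach {suc L} {x} {y} (_∷ʳ_ {y = z} r e) =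
    ∨-introʳ (reach G L x y)
      (any-intro (λ w → reach G L x w ∧ G w y) (allFin n) (∈-allFin z) (∧-intro (Reach⇒reach r) e))

  distAux-≥ : ∀ x y k f → k ≤ distAux G x y k f
  distAux-≥ x y k zero = ≤-refl
  distAux-≥ x y k (suc f) with reach G k x y
  ... | true = ≤-refl
  ... | false = ≤-trans (n≤1+n k) (distAux-≥ x y (suc k) f)

  distAux-≤ : ∀ x y k f → distAux G x y k f ≤ k + f
  distAux-≤ x y k zero = ≤-reflexive (sym (+-identityʳ k))
  distAux-≤ x y k (suc f) with reach G k x y
  ... | true = m≤m+n k (suc f)
  ... | false = ≤-trans (distAux-≤ x y (suc k) f) (≤-reflexive (sym (+-suc k f)))

  distAux-least : ∀ x y k f {L} → k ≤ L → reach G L x y ≡ true → distAux G x y k f ≤ L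
  distAux-least x y k zero k≤L _ = k≤L
  distAux-least x y k (suc f) {L} k≤L r with reach G k x y in eq
  ... | true = k≤L
  ... | false = distAux-least x y (suc k) f (≤∧≢⇒< k≤L k≢L) r
    where
    k≢L : ¬ k ≡ L
    k≢L refl with () ← trans (sym eq) r

  distAux-reached : ∀ x y k f → reach G (distAux G x y k f) x y ≡ true ⊎ distAux G x y k f ≡ k + f
  distAux-reached x y k zero = inj₂ (sym (+-identityʳ k))
  distAux-reached x y k (suc f) with reach G k x y in eq
  ... | true = inj₁ eq
  ... | false with distAux-reached x y (suc k) f
  ...   | inj₁ r = inj₁ r
  ...   | inj₂ d≡ = inj₂ (trans d≡ (sym (+-suc k f)))

  -- A distance is either realised by a walk or equals the junk value n.
  dist-reached : ∀ x y → Reach G (dist G x y) x y ⊎ dist G x y ≡ n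
  dist-reached x y with distAux-reached x y 0 n
  ... | inj₁ r = inj₁ (reach⇒Reach _ x y r)
  ... | inj₂ d≡n = inj₂ d≡n

  dist≤ : ∀ {L x y} → Reach G L x y → dist G x y ≤ L
  dist≤ {L} {x} {y} r = distAux-least x y 0 n z≤n (Reach⇒reach r)

  dist≤n : ∀ x y → dist G x y ≤ n
  dist≤n x y = distAux-≤ x y 0 n

  ≤dist : ∀ {M} x y → M ≤ n → (∀ L → Reach G L x y → M ≤ L) → M ≤ dist G x y
  ≤dist {M} x y M≤n bound with dist-reached x y
  ... | inj₁ r = bound _ r
  ... | inj₂ d≡n = subst (M ≤_) (sym d≡n) M≤n

  dist-refl : ∀ x → dist G x x ≡ 0
  dist-refl x = n≤0⇒n≡0 (dist≤ {0} [])

  1≤dist : ∀ {x y} → ¬ x ≡ y → 1 ≤ dist G x y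
  1≤dist {x} {y} x≢y = ≤dist x y (≤-trans (s≤s z≤n) (toℕ<n x)) λ where
    zero r → contradiction (Reach-0⇒≡ r) x≢y
    (suc L) r → s≤s z≤n

  dist-Lipschitz : ∀ w → Lipschitz G (dist G w)
  dist-Lipschitz w x y e with dist-reached w x
  ... | inj₁ r = dist≤ (r ∷ʳ e)
  ... | inj₂ d≡n = ≤-trans (dist≤n w y) (≤-trans (≤-reflexive (sym d≡n)) (n≤1+n _))

  Lipschitz⇒≤dist : ∀ {h} → Lipschitz G h → ∀ x y → (h y ∸ h x) ⊓ n ≤ dist G x y
  Lipschitz⇒≤dist {h} lip x y = ≤dist x y (m⊓n≤n _ n) λ L r →
    ≤-trans (m⊓n≤m _ n) (m≤n+o⇒m∸n≤o (h y) (h x) (subst (h y ≤_) (+-comm L (h x)) (Lipschitz-Reach lip r)))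

  dist-++ : ∀ w {x y s} → Reach G s x y → dist G w y ≤ (dist G w x + s) ⊓ n
  dist-++ w {x} {y} r with dist-reached w x
  ... | inj₁ r′ = ⊓-glb (dist≤ (r′ ++ r)) (dist≤n w y)
  ... | inj₂ d≡n rewrite d≡n = ⊓-glb (≤-trans (dist≤n w y) (m≤m+n n _)) (dist≤n w y)

Reach-map : ∀ {n n′} {A : Adj n} {B : Adj n′} {f} → WeakHom A B f → ∀ {L x y} → Reach A L x y → Reach B L (f x) (f y)
Reach-map hom [] = []
Reach-map {B = B} {f} hom (_∷ʳ_ {L = L} {x = x} {y = y} {z = z} r e) with hom y z e
... | inj₁ fy≡fz = Reach-weaken (n≤1+n L) (subst (Reach B L (f x)) fy≡fz (Reach-map hom r))
... | inj₂ e′ = Reach-map hom r ∷ʳ e′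

distAux-mono : ∀ {n n′} (G : Adj n) (G′ : Adj n′) x y x′ y′ →
               (∀ L → reach G′ L x′ y′ ≡ true → reach G L x y ≡ true) →
               ∀ k f → distAux G x y k f ≤ distAux G′ x′ y′ k f
distAux-mono G G′ x y x′ y′ imp k zero = ≤-refl
distAux-mono G G′ x y x′ y′ imp k (suc f) with reach G′ k x′ y′ in eq
... | true rewrite imp k eq = ≤-refl
... | false with reach G k x y
...   | true = ≤-trans (n≤1+n k) (distAux-≥ {G = G′} x′ y′ (suc k) f)
...   | false = distAux-mono G G′ x y x′ y′ imp (suc k) f

-- Finite sums

sum-tabulate : ∀ {A : Set} n (g : Fin n → A) (f : A → ℕ) →
               ListAction.sum (map f (tabulate g)) ≡ sum (f ∘ g)
sum-tabulate zero g f = refl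
sum-tabulate (suc n) g f = cong (f (g zero) +_) (sum-tabulate n (g ∘ suc) f)

sum-allFin : ∀ n (f : Fin n → ℕ) → ListAction.sum (map f (allFin n)) ≡ sum f
sum-allFin n = sum-tabulate n id

sum-mono-≤ : ∀ {n} {f g : Fin n → ℕ} → (∀ i → f i ≤ g i) → sum f ≤ sum g
sum-mono-≤ {zero} f≤g = z≤n
sum-mono-≤ {suc n} f≤g = +-mono-≤ (f≤g zero) (sum-mono-≤ (f≤g ∘ suc))

sum-mono-< : ∀ {n} {f g : Fin n → ℕ} (c : Fin n) → (∀ i → f i ≤ g i) → f c < g c → sum f < sum g
sum-mono-< {suc n} {f} {g} c f≤g fc<gc
  rewrite sum-remove {i = c} f | sum-remove {i = c} g =
  +-mono-<-≤ fc<gc (sum-mono-≤ (f≤g ∘ punchIn c))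

sum-++ : ∀ n m (f : Fin (n + m) → ℕ) → sum f ≡ sum (λ i → f (i ↑ˡ m)) + sum (λ b → f (n ↑ʳ b))
sum-++ zero m f = refl
sum-++ (suc n) m f rewrite sum-++ n m (f ∘ suc) = sym (+-assoc (f zero) _ _)

sumRange : ℕ → (ℕ → ℕ) → ℕ
sumRange zero g = 0
sumRange (suc n) g = g 0 + sumRange n (g ∘ suc)

sum-toℕ : ∀ n (g : ℕ → ℕ) → sum (g ∘ toℕ {n}) ≡ sumRange n g
sum-toℕ zero g = refl
sum-toℕ (suc n) g = cong (g 0 +_) (sum-toℕ n (g ∘ suc))

sumRange-cong : ∀ n {g h : ℕ → ℕ} → (∀ j → j < n → g j ≡ h j) → sumRange n g ≡ sumRange n h
sumRange-cong zero g≡h = refl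
sumRange-cong (suc n) g≡h = cong₂ _+_ (g≡h 0 (s≤s z≤n)) (sumRange-cong n (λ j j<n → g≡h (suc j) (s≤s j<n)))

sumRange-mono-≤ : ∀ n {g h : ℕ → ℕ} → (∀ j → j < n → g j ≤ h j) → sumRange n g ≤ sumRange n h
sumRange-mono-≤ zero g≤h = z≤n
sumRange-mono-≤ (suc n) g≤h = +-mono-≤ (g≤h 0 (s≤s z≤n)) (sumRange-mono-≤ n (λ j j<n → g≤h (suc j) (s≤s j<n)))

sumRange-snoc : ∀ n (g : ℕ → ℕ) → sumRange (suc n) g ≡ sumRange n g + g n
sumRange-snoc zero g = +-comm (g 0) 0
sumRange-snoc (suc n) g rewrite sumRange-snoc n (g ∘ suc) = sym (+-assoc (g 0) _ _)

sumRange-+ : ∀ a b (g : ℕ → ℕ) → sumRange (a + b) g ≡ sumRange a g + sumRange b (λ j → g (a + j))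
sumRange-+ zero b g = refl
sumRange-+ (suc a) b g rewrite sumRange-+ a b (g ∘ suc) = sym (+-assoc (g 0) _ _)

sumRange-reverse : ∀ n (g : ℕ → ℕ) → sumRange n g ≡ sumRange n (λ j → g (n ∸ suc j))
sumRange-reverse zero g = refl
sumRange-reverse (suc n) g = begin
  g 0 + sumRange n (g ∘ suc)                       ≡⟨ cong (g 0 +_) (sumRange-reverse n (g ∘ suc)) ⟩
  g 0 + sumRange n (λ j → g (suc (n ∸ suc j)))    ≡⟨ cong (g 0 +_) (sumRange-cong n (λ j j<n → cong g (+-∸-assoc 1 j<n))) ⟨
  g 0 + sumRange n (λ j → g (n ∸ j))               ≡⟨ +-comm (g 0) _ ⟩
  sumRange n (λ j → g (n ∸ j)) + g 0               ≡⟨ cong (λ z → sumRange n (λ j → g (n ∸ j)) + g z) (n∸n≡0 n) ⟨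
  sumRange n (λ j → g (n ∸ j)) + g (n ∸ n)         ≡⟨ sumRange-snoc n (λ j → g (n ∸ j)) ⟨
  sumRange (suc n) (λ j → g (n ∸ j))               ∎
  where open ≡-Reasoning

upper : ∀ {n} → (Fin n → Fin n → ℕ) → Fin n → Fin n → ℕ
upper f x y = if toℕ x <ᵇ toℕ y then f x y else 0

pairSum : ∀ {n} → (Fin n → Fin n → ℕ) → ℕ
pairSum {n} f = ∑[ x < n ] ∑[ y < n ] upper f x y

W≡pairSum : ∀ {n} (G : Adj n) → W G ≡ pairSum (dist G)
W≡pairSum {n} G = trans (sum-allFin n _) (sum-cong-≗ {n} (λ x → sum-allFin n _))

upper-diag : ∀ {n} (f : Fin n → Fin n → ℕ) x → upper f x x ≡ 0
upper-diag f x rewrite <ᵇ-false (<-irrefl (refl {x = toℕ x})) = refl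

upper-+-sym : ∀ {n} (f : Fin n → Fin n → ℕ) {x y} → f x y ≡ f y x → ¬ x ≡ y →
              upper f x y + upper f y x ≡ f x y
upper-+-sym f {x} {y} fxy≡fyx x≢y with <-cmp (toℕ x) (toℕ y)
... | tri< x<y _ _ rewrite <ᵇ-true x<y | <ᵇ-false (<⇒≯ x<y) = +-identityʳ _
... | tri≈ _ x≡y _ = contradiction (toℕ-injective x≡y) x≢y
... | tri> _ _ x>y rewrite <ᵇ-true x>y | <ᵇ-false (<⇒≯ x>y) = sym fxy≡fyx

<ᵇ-punchIn : ∀ {m} (c : Fin (suc m)) (a b : Fin m) →
             (toℕ (punchIn c a) <ᵇ toℕ (punchIn c b)) ≡ (toℕ a <ᵇ toℕ b)
<ᵇ-punchIn c a b = det (<ᵇ-reflects-< _ _) (fromEquivalence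
  (λ t → ≰⇒> (λ pb≤pa → <⇒≱ (<ᵇ⇒< _ _ t) (punchIn-cancel-≤ c b a pb≤pa)))
  (λ pa<pb → <⇒<ᵇ (≰⇒> (λ b≤a → <⇒≱ pa<pb (punchIn-mono-≤ c b a b≤a)))))

toℕ-punchIn-< : ∀ {m} (c : Fin (suc m)) (b : Fin m) → toℕ b < toℕ c → toℕ (punchIn c b) ≡ toℕ b
toℕ-punchIn-< {suc m} (suc c) zero _ = refl
toℕ-punchIn-< {suc m} (suc c) (suc b) (s≤s b<c) = cong suc (toℕ-punchIn-< c b b<c)

upper-punchIn : ∀ {m} (f : Fin (suc m) → Fin (suc m) → ℕ) c a b →
                upper f (punchIn c a) (punchIn c b) ≡ upper (λ x y → f (punchIn c x) (punchIn c y)) a b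
upper-punchIn f c a b rewrite <ᵇ-punchIn c a b = refl

pairSum-punchIn : ∀ {m} (f : Fin (suc m) → Fin (suc m) → ℕ) → (∀ x y → f x y ≡ f y x) → (c : Fin (suc m)) →
                  pairSum f ≡ ∑[ b < m ] f c (punchIn c b) + pairSum (λ x y → f (punchIn c x) (punchIn c y))
pairSum-punchIn {m} f f-sym c = begin
  pairSum f
    ≡⟨ sum-remove {i = c} (λ x → ∑[ y < suc m ] u x y) ⟩
  ∑[ y < suc m ] u c y + ∑[ a < m ] ∑[ y < suc m ] u (p a) y
    ≡⟨ cong₂ _+_ (sum-remove {i = c} (u c)) (sum-cong-≗ {m} (λ a → sum-remove {i = c} (u (p a)))) ⟩
  (u c c + ∑[ b < m ] u c (p b)) + ∑[ a < m ] (u (p a) c + ∑[ b < m ] u (p a) (p b))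
    ≡⟨ cong₂ (λ z w → (z + ∑[ b < m ] u c (p b)) + w) (upper-diag f c) (∑-distrib-+ {m} (λ a → u (p a) c) _) ⟩
  ∑[ b < m ] u c (p b) + (∑[ a < m ] u (p a) c + ∑[ a < m ] ∑[ b < m ] u (p a) (p b))
    ≡⟨ +-assoc (∑[ b < m ] u c (p b)) _ _ ⟨
  (∑[ b < m ] u c (p b) + ∑[ a < m ] u (p a) c) + ∑[ a < m ] ∑[ b < m ] u (p a) (p b)
    ≡⟨ cong₂ _+_ (trans (sum-cong-≗ {m} cross) (∑-distrib-+ {m} (λ b → u c (p b)) _))
                 (sym (sum-cong-≗ {m} (λ a → sum-cong-≗ {m} (upper-punchIn f c a)))) ⟨
  ∑[ b < m ] f c (p b) + pairSum (λ x y → f (p x) (p y)) ∎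
  where
  open ≡-Reasoning
  p = punchIn c
  u = upper f
  cross : ∀ b → f c (p b) ≡ u c (p b) + u (p b) c
  cross b = sym (upper-+-sym f (f-sym c (p b)) (λ c≡pb → punchInᵢ≢i c b (sym c≡pb)))

↑ˡ<↑ʳ : ∀ {n m} (i : Fin n) (b : Fin m) → toℕ (i ↑ˡ m) < toℕ (n ↑ʳ b)
↑ˡ<↑ʳ {n} {m} i b rewrite toℕ-↑ˡ i m | toℕ-↑ʳ n b = ≤-trans (toℕ<n i) (m≤m+n n (toℕ b))

<ᵇ-+ˡ : ∀ n a b → (n + a <ᵇ n + b) ≡ (a <ᵇ b)
<ᵇ-+ˡ zero a b = refl
<ᵇ-+ˡ (suc n) a b = <ᵇ-+ˡ n a b

module _ {n m : ℕ} (f : Fin (n + m) → Fin (n + m) → ℕ) where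

  upper-↑ˡ↑ˡ : ∀ i j → upper f (i ↑ˡ m) (j ↑ˡ m) ≡ upper (λ x y → f (x ↑ˡ m) (y ↑ˡ m)) i j
  upper-↑ˡ↑ˡ i j rewrite toℕ-↑ˡ i m | toℕ-↑ˡ j m = refl

  upper-↑ˡ↑ʳ : ∀ i b → upper f (i ↑ˡ m) (n ↑ʳ b) ≡ f (i ↑ˡ m) (n ↑ʳ b)
  upper-↑ˡ↑ʳ i b rewrite <ᵇ-true (↑ˡ<↑ʳ i b) = refl

  upper-↑ʳ↑ˡ : ∀ a j → upper f (n ↑ʳ a) (j ↑ˡ m) ≡ 0
  upper-↑ʳ↑ˡ a j rewrite <ᵇ-false (<⇒≯ (↑ˡ<↑ʳ j a)) = refl

  upper-↑ʳ↑ʳ : ∀ a b → upper f (n ↑ʳ a) (n ↑ʳ b) ≡ upper (λ x y → f (n ↑ʳ x) (n ↑ʳ y)) a b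
  upper-↑ʳ↑ʳ a b rewrite toℕ-↑ʳ n a | toℕ-↑ʳ n b | <ᵇ-+ˡ n (toℕ a) (toℕ b) = refl

  pairSum-++ : pairSum f ≡ pairSum (λ i j → f (i ↑ˡ m) (j ↑ˡ m))
                         + ∑[ i < n ] ∑[ b < m ] f (i ↑ˡ m) (n ↑ʳ b)
                         + pairSum (λ a b → f (n ↑ʳ a) (n ↑ʳ b))
  pairSum-++ = begin
    pairSum f
      ≡⟨ sum-cong-≗ {n + m} (λ z → sum-++ n m (u z)) ⟩
    ∑[ z < n + m ] (∑[ j < n ] u z (j ↑ˡ m) + ∑[ b < m ] u z (n ↑ʳ b))
      ≡⟨ sum-++ n m _ ⟩
    ∑[ i < n ] (∑[ j < n ] u (i ↑ˡ m) (j ↑ˡ m) + ∑[ b < m ] u (i ↑ˡ m) (n ↑ʳ b))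
      + ∑[ a < m ] (∑[ j < n ] u (n ↑ʳ a) (j ↑ˡ m) + ∑[ b < m ] u (n ↑ʳ a) (n ↑ʳ b))
      ≡⟨ cong₂ _+_ (∑-distrib-+ {n} (λ i → ∑[ j < n ] u (i ↑ˡ m) (j ↑ˡ m)) _)
                   (∑-distrib-+ {m} (λ a → ∑[ j < n ] u (n ↑ʳ a) (j ↑ˡ m)) _) ⟩
    (∑[ i < n ] ∑[ j < n ] u (i ↑ˡ m) (j ↑ˡ m) + ∑[ i < n ] ∑[ b < m ] u (i ↑ˡ m) (n ↑ʳ b))
      + (∑[ a < m ] ∑[ j < n ] u (n ↑ʳ a) (j ↑ˡ m) + ∑[ a < m ] ∑[ b < m ] u (n ↑ʳ a) (n ↑ʳ b))
      ≡⟨ cong₂ _+_ (cong₂ _+_ (sum-cong-≗ {n} (λ i → sum-cong-≗ {n} (upper-↑ˡ↑ˡ i)))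
                              (sum-cong-≗ {n} (λ i → sum-cong-≗ {m} (upper-↑ˡ↑ʳ i))))
                   (cong₂ _+_ (trans (sum-cong-≗ {m} (λ a → trans (sum-cong-≗ {n} (upper-↑ʳ↑ˡ a)) (sum-replicate-zero n)))
                                     (sum-replicate-zero m))
                              (sum-cong-≗ {m} (λ a → sum-cong-≗ {m} (upper-↑ʳ↑ʳ a)))) ⟩
    (pairSum (λ i j → f (i ↑ˡ m) (j ↑ˡ m)) + ∑[ i < n ] ∑[ b < m ] f (i ↑ˡ m) (n ↑ʳ b))
      + (0 + pairSum (λ a b → f (n ↑ʳ a) (n ↑ʳ b)))
      ∎
    where
    open ≡-Reasoning
    u = upper f

pairSum-toℕ : ∀ n (F : ℕ → ℕ → ℕ) →
              pairSum (λ (x y : Fin n) → F (toℕ x) (toℕ y))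
              ≡ sumRange n (λ x → sumRange n (λ y → if x <ᵇ y then F x y else 0))
pairSum-toℕ n F = trans (sum-cong-≗ {n} (λ x → sum-toℕ n (λ y → if toℕ x <ᵇ y then F (toℕ x) y else 0)))
                        (sum-toℕ n (λ x → sumRange n (λ y → if x <ᵇ y then F x y else 0)))

pairSum-mono-≤ : ∀ {n} {f g : Fin n → Fin n → ℕ} → (∀ x y → toℕ x < toℕ y → f x y ≤ g x y) → pairSum f ≤ pairSum g
pairSum-mono-≤ {n} {f} {g} f≤g = sum-mono-≤ λ x → sum-mono-≤ λ y → upper-mono x y
  where
  upper-mono : ∀ x y → upper f x y ≤ upper g x y
  upper-mono x y with toℕ x <ᵇ toℕ y in x<ᵇy
  ... | true = f≤g x y (<ᵇ⇒< _ _ (subst T (sym x<ᵇy) _))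
  ... | false = z≤n

-- Gluing

-- Vertices of glue H v K u: inH i for i in H, inK b for the vertex punchIn u b of K.
module Glue {n m : ℕ} (H : Adj n) (v : Fin n) (K : Adj (suc m)) (u : Fin (suc m)) where

  N : ℕ
  N = n + m

  G : Adj N
  G = glue H v K u

  inH : Fin n → Fin N
  inH i = i ↑ˡ m

  inK : Fin m → Fin N
  inK b = n ↑ʳ b

  glue-HH : ∀ i j → G (inH i) (inH j) ≡ H i j
  glue-HH i j rewrite splitAt-↑ˡ n i m | splitAt-↑ˡ n j m = refl

  glue-HK : ∀ i b → G (inH i) (inK b) ≡ ⌊ i ≟ v ⌋ ∧ K u (punchIn u b)
  glue-HK i b rewrite splitAt-↑ˡ n i m | splitAt-↑ʳ n m b = refl

  glue-KH : ∀ a j → G (inK a) (inH j) ≡ ⌊ j ≟ v ⌋ ∧ K (punchIn u a) u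
  glue-KH a j rewrite splitAt-↑ʳ n m a | splitAt-↑ˡ n j m = refl

  glue-KK : ∀ a b → G (inK a) (inK b) ≡ K (punchIn u a) (punchIn u b)
  glue-KK a b rewrite splitAt-↑ʳ n m a | splitAt-↑ʳ n m b = refl

  data Side : Fin N → Set where
    sideH : ∀ i → Side (inH i)
    sideK : ∀ b → Side (inK b)

  side : ∀ z → Side z
  side z with splitAt n z in eq
  ... | inj₁ i = subst Side (splitAt⁻¹-↑ˡ eq) (sideH i)
  ... | inj₂ b = subst Side (splitAt⁻¹-↑ʳ eq) (sideK b)

  inH≢inK : ∀ i b → ¬ inH i ≡ inK b
  inH≢inK i b eq = <-irrefl (cong toℕ eq) (↑ˡ<↑ʳ i b)

  toH : Fin N → Fin n
  toH z = [ id , const v ] (splitAt n z)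

  toK : Fin N → Fin (suc m)
  toK z = [ const u , punchIn u ] (splitAt n z)

  toH-inH : ∀ i → toH (inH i) ≡ i
  toH-inH i rewrite splitAt-↑ˡ n i m = refl

  toH-inK : ∀ b → toH (inK b) ≡ v
  toH-inK b rewrite splitAt-↑ʳ n m b = refl

  toK-inH : ∀ i → toK (inH i) ≡ u
  toK-inH i rewrite splitAt-↑ˡ n i m = refl

  toK-inK : ∀ b → toK (inK b) ≡ punchIn u b
  toK-inK b rewrite splitAt-↑ʳ n m b = refl

  glue-edge : ∀ x y → G x y ≡ true →
              (toK x ≡ toK y × H (toH x) (toH y) ≡ true) ⊎ (toH x ≡ toH y × K (toK x) (toK y) ≡ true)
  glue-edge x y e with side x | side y
  ... | sideH i | sideH j rewrite toK-inH i | toK-inH j | toH-inH i | toH-inH j =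
    inj₁ (refl , trans (sym (glue-HH i j)) e)
  ... | sideH i | sideK b rewrite toK-inH i | toK-inK b | toH-inH i | toH-inK b =
    let e′ = trans (sym (glue-HK i b)) e in inj₂ (≟-true⇒≡ (∧-elimˡ _ e′) , ∧-elimʳ _ e′)
  ... | sideK a | sideH j rewrite toK-inK a | toK-inH j | toH-inK a | toH-inH j =
    let e′ = trans (sym (glue-KH a j)) e in inj₂ (sym (≟-true⇒≡ (∧-elimˡ _ e′)) , ∧-elimʳ _ e′)
  ... | sideK a | sideK b rewrite toK-inK a | toK-inK b | toH-inK a | toH-inK b =
    inj₂ (refl , trans (sym (glue-KK a b)) e)

  toH-hom : WeakHom G H toH
  toH-hom x y e with glue-edge x y e
  ... | inj₁ (_ , eH) = inj₂ eH
  ... | inj₂ (toHx≡toHy , _) = inj₁ toHx≡toHy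

  toK-hom : WeakHom G K toK
  toK-hom x y e with glue-edge x y e
  ... | inj₁ (toKx≡toKy , _) = inj₁ toKx≡toKy
  ... | inj₂ (_ , eK) = inj₂ eK

  inH-hom : WeakHom H G inH
  inH-hom i j e = inj₂ (trans (glue-HH i j) e)

  fromK : Fin (suc m) → Fin N
  fromK y with u ≟ y
  ... | yes _ = inH v
  ... | no u≢y = inK (punchOut u≢y)

  fromK-u : fromK u ≡ inH v
  fromK-u with u ≟ u
  ... | yes _ = refl
  ... | no u≢u = contradiction refl u≢u

  fromK-punchIn : ∀ b → fromK (punchIn u b) ≡ inK b
  fromK-punchIn b with u ≟ punchIn u b
  ... | yes u≡pb = contradiction (sym u≡pb) (punchInᵢ≢i u b)
  ... | no u≢pb = cong inK (punchIn-injective u _ b (punchIn-punchOut u≢pb))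

  data KSide : Fin (suc m) → Set where
    base  : KSide u
    other : ∀ b → KSide (punchIn u b)

  kside : ∀ y → KSide y
  kside y with u ≟ y
  ... | yes refl = base
  ... | no u≢y = subst KSide (punchIn-punchOut u≢y) (other (punchOut u≢y))

  fromK-hom : WeakHom K G fromK
  fromK-hom x y e with kside x | kside y
  ... | base | base = inj₁ refl
  ... | base | other b rewrite fromK-u | fromK-punchIn b =
    inj₂ (trans (glue-HK v b) (trans (cong (_∧ K u (punchIn u b)) (⌊≟⌋-refl v)) e))
  ... | other a | base rewrite fromK-u | fromK-punchIn a =
    inj₂ (trans (glue-KH a v) (trans (cong (_∧ K (punchIn u a) u) (⌊≟⌋-refl v)) e))
  ... | other a | other b rewrite fromK-punchIn a | fromK-punchIn b = inj₂ (trans (glue-KK a b) e)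

  dist-inH : ∀ i j → dist G (inH i) (inH j) ≡ distAux H i j 0 N
  dist-inH i j = ≤-antisym
    (distAux-mono G H (inH i) (inH j) i j
      (λ L e → Reach⇒reach (Reach-map inH-hom (reach⇒Reach L i j e))) 0 N)
    (distAux-mono H G i j (inH i) (inH j)
      (λ L e → Reach⇒reach (subst₂ (Reach H L) (toH-inH i) (toH-inH j)
                                    (Reach-map toH-hom (reach⇒Reach L (inH i) (inH j) e)))) 0 N)

  dist-inK≤ : ∀ a b {s} → Reach K s (punchIn u a) (punchIn u b) → dist G (inK a) (inK b) ≤ s
  dist-inK≤ a b r = subst₂ (λ x y → dist G x y ≤ _) (fromK-punchIn a) (fromK-punchIn b) (dist≤ (Reach-map fromK-hom r))

  dist-inHv-inK≤ : ∀ b {s} → Reach K s u (punchIn u b) → dist G (inH v) (inK b) ≤ s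
  dist-inHv-inK≤ b r = subst₂ (λ x y → dist G x y ≤ _) fromK-u (fromK-punchIn b) (dist≤ (Reach-map fromK-hom r))

  1≤dist-inH-inK : ∀ i b → 1 ≤ dist G (inH i) (inK b)
  1≤dist-inH-inK i b = 1≤dist (inH≢inK i b)

  1≤dist-inK : ∀ {a b} → ¬ a ≡ b → 1 ≤ dist G (inK a) (inK b)
  1≤dist-inK {a} {b} a≢b = 1≤dist (a≢b ∘ ↑ʳ-injective n a b)

  d : Fin n → ℕ
  d i = dist G (inH i) (inH v)

  dist-inH-inK≤ : ∀ i b {s} → Reach K s u (punchIn u b) → dist G (inH i) (inK b) ≤ (d i + s) ⊓ N
  dist-inH-inK≤ i b r =
    subst₂ (λ x y → dist G (inH i) y ≤ (dist G (inH i) x + _) ⊓ N) fromK-u (fromK-punchIn b)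
      (dist-++ (inH i) (Reach-map fromK-hom r))

  -- h adds the H-distance read through toH to t read through toK; an edge of G moves at most one of the two.
  ≤dist-inH-inK : ∀ {t} → Lipschitz K t → t u ≡ 0 → ∀ i b → (d i + t (punchIn u b)) ⊓ N ≤ dist G (inH i) (inK b)
  ≤dist-inH-inK {t} t-lip tu≡0 i b =
    subst (λ z → z ⊓ N ≤ dist G (inH i) (inK b)) h-diff (Lipschitz⇒≤dist h-lip (inH i) (inK b))
    where
    h : Fin N → ℕ
    h z = dist G (inH i) (inH (toH z)) + t (toK z)
    h-lip : Lipschitz G h
    h-lip x y e with glue-edge x y e
    ... | inj₁ (toKx≡toKy , eH) rewrite toKx≡toKy =
      +-monoˡ-≤ (t (toK y)) (dist-Lipschitz (inH i) (inH (toH x)) (inH (toH y)) (trans (glue-HH _ _) eH))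
    ... | inj₂ (toHx≡toHy , eK) rewrite toHx≡toHy =
      ≤-trans (+-monoʳ-≤ (dist G (inH i) (inH (toH y))) (t-lip _ _ eK)) (≤-reflexive (+-suc _ _))
    h-diff : h (inK b) ∸ h (inH i) ≡ d i + t (punchIn u b)
    h-diff rewrite toH-inK b | toK-inK b | toH-inH i | toK-inH i | tu≡0 | dist-refl {G = G} (inH i) = refl

  Lipschitz⇒≤dist-inK : ∀ {t} → Lipschitz K t → ∀ a b →
                        (t (punchIn u b) ∸ t (punchIn u a)) ⊓ N ≤ dist G (inK a) (inK b)
  Lipschitz⇒≤dist-inK {t} t-lip a b =
    subst₂ (λ x y → (t y ∸ t x) ⊓ N ≤ dist G (inK a) (inK b)) (toK-inK a) (toK-inK b)
      (Lipschitz⇒≤dist (Lipschitz-∘ toK-hom t-lip) (inK a) (inK b))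

  d-v : d v ≡ 0
  d-v = dist-refl (inH v)

  row : Fin n → ℕ
  row i = ∑[ b < m ] dist G (inH i) (inK b)

  Hpart Kpairs Kpart : ℕ
  Hpart = pairSum (λ i j → dist G (inH i) (inH j))
  Kpairs = pairSum (λ a b → dist G (inK a) (inK b))
  Kpart = row v + Kpairs

  Hpart≡ : Hpart ≡ pairSum (λ i j → distAux H i j 0 N)
  Hpart≡ = sum-cong-≗ {n} λ i → sum-cong-≗ {n} λ j → cong (if toℕ i <ᵇ toℕ j then_else 0) (dist-inH i j)

  W-glue : W G ≡ Hpart + ∑[ i < n ] row i + Kpairs
  W-glue = trans (W≡pairSum G) (pairSum-++ {n} {m} (dist G))

  Kpart≤pairSum : ∀ (F : Fin (suc m) → Fin (suc m) → ℕ) → (∀ x y → F x y ≡ F y x) →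
                  (∀ b → dist G (inH v) (inK b) ≤ F u (punchIn u b)) →
                  (∀ a b → dist G (inK a) (inK b) ≤ F (punchIn u a) (punchIn u b)) →
                  Kpart ≤ pairSum F
  Kpart≤pairSum F F-sym row≤ inner≤ = subst (Kpart ≤_) (sym (pairSum-punchIn F F-sym u))
    (+-mono-≤ (sum-mono-≤ row≤) (pairSum-mono-≤ (λ a b _ → inner≤ a b)))

  pairSum≤Kpart : ∀ (F : Fin (suc m) → Fin (suc m) → ℕ) → (∀ x y → F x y ≡ F y x) →
                  (∀ b → F u (punchIn u b) ≤ dist G (inH v) (inK b)) →
                  (∀ a b → toℕ a < toℕ b → F (punchIn u a) (punchIn u b) ≤ dist G (inK a) (inK b)) →
                  pairSum F ≤ Kpart
  pairSum≤Kpart F F-sym ≤row ≤inner = subst (_≤ Kpart) (sym (pairSum-punchIn F F-sym u))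
    (+-mono-≤ (sum-mono-≤ ≤row) (pairSum-mono-≤ ≤inner))

-- Cycles

Reach-ascending : ∀ {k} {G : Adj k} → (∀ x y → suc (toℕ x) ≡ toℕ y → G x y ≡ true) →
                  ∀ d x y → toℕ x + d ≡ toℕ y → Reach G d x y
Reach-ascending {G = G} up zero x y x+0≡y = subst (Reach G 0 x) (toℕ-injective (trans (sym (+-identityʳ _)) x+0≡y)) []
Reach-ascending {k} up (suc d) x y x+d+1≡y =
  Reach-ascending up d x z (sym (toℕ-fromℕ< x+d<k)) ∷ʳ up z y (trans (cong suc (toℕ-fromℕ< x+d<k)) x+1+d≡y)
  where
  x+1+d≡y : suc (toℕ x + d) ≡ toℕ y
  x+1+d≡y = trans (sym (+-suc (toℕ x) d)) x+d+1≡y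
  x+d<k : toℕ x + d < k
  x+d<k = ≤-trans (≤-reflexive x+1+d≡y) (<⇒≤ (toℕ<n y))
  z = fromℕ< x+d<k

cycDist : ℕ → ℕ → ℕ → ℕ
cycDist k a b = ∣ a - b ∣ ⊓ (k ∸ ∣ a - b ∣)

cycDist-comm : ∀ k a b → cycDist k a b ≡ cycDist k b a
cycDist-comm k a b rewrite ∣-∣-comm a b = refl

cycDist-self : ∀ k a → cycDist k a a ≡ 0
cycDist-self k a rewrite ∣n-n∣≡0 a = refl

cycle-sym : ∀ k (x y : Fin k) → cycle k x y ≡ cycle k y x
cycle-sym k x y = ∨-comm (cycleEdge k (toℕ x) (toℕ y)) _

cycle-suc : ∀ k (x y : Fin k) → suc (toℕ x) ≡ toℕ y → cycle k x y ≡ true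
cycle-suc k x y x+1≡y rewrite x+1≡y | ≡ᵇ-refl (toℕ y) = refl

cycle-wrap : ∀ k (x y : Fin k) → suc (toℕ x) ≡ k → toℕ y ≡ 0 → cycle k x y ≡ true
cycle-wrap k x y x+1≡k y≡0 rewrite x+1≡k | y≡0 | ≡ᵇ-refl k =
  ∨-introˡ _ (∨-introʳ (k ≡ᵇ 0) refl)

around-length : ∀ a b m → a ≤ b → b ≤ m → (m ∸ b) + 1 + a ≡ suc m ∸ (b ∸ a)
around-length zero b m z≤n b≤m = trans (+-identityʳ _) (trans (+-comm (m ∸ b) 1) (sym (+-∸-assoc 1 b≤m)))
around-length (suc a) (suc b) (suc m) (s≤s a≤b) (s≤s b≤m) =
  trans (+-suc (m ∸ b + 1) a) (trans (cong suc (around-length a b m a≤b b≤m))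
    (sym (+-∸-assoc 1 (≤-trans (m∸n≤m b a) (≤-trans b≤m (n≤1+n m))))))

module _ (m : ℕ) where

  private
    k = suc m
    C = cycle k

  cycle-Reach-≤ : ∀ (x y : Fin k) → toℕ x ≤ toℕ y → Reach C (cycDist k (toℕ x) (toℕ y)) x y
  cycle-Reach-≤ x y x≤y =
    subst (λ z → Reach C (z ⊓ (k ∸ z)) x y) (sym (m≤n⇒∣m-n∣≡n∸m x≤y)) (Reach-⊓ forward backward)
    where
    forward : Reach C (toℕ y ∸ toℕ x) x y
    forward = Reach-ascending (cycle-suc k) _ x y (m+[n∸m]≡n x≤y)
    y→last : Reach C (m ∸ toℕ y) y (fromℕ m)
    y→last = Reach-ascending (cycle-suc k) _ y (fromℕ m) (trans (m+[n∸m]≡n (≤-pred (toℕ<n y))) (sym (toℕ-fromℕ m)))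
    last→0 : Reach C 1 (fromℕ m) zero
    last→0 = [] ∷ʳ cycle-wrap k (fromℕ m) zero (cong suc (toℕ-fromℕ m)) refl
    0→x : Reach C (toℕ x) zero x
    0→x = Reach-ascending (cycle-suc k) _ zero x refl
    backward : Reach C (k ∸ (toℕ y ∸ toℕ x)) x y
    backward = subst (λ L → Reach C L x y) (around-length (toℕ x) (toℕ y) m x≤y (≤-pred (toℕ<n y)))
                     (Reach-reverse (cycle-sym k) ((y→last ++ last→0) ++ 0→x))

  cycle-Reach : ∀ (x y : Fin k) → Reach C (cycDist k (toℕ x) (toℕ y)) x y
  cycle-Reach x y with ≤-total (toℕ x) (toℕ y)
  ... | inj₁ x≤y = cycle-Reach-≤ x y x≤y
  ... | inj₂ y≤x = subst (λ L → Reach C L x y) (cycDist-comm k (toℕ y) (toℕ x))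
                         (Reach-reverse (cycle-sym k) (cycle-Reach-≤ y x y≤x))

-- Split the range at c and read the part before c backwards.
sumRange-cycDist-rotate : ∀ m c → c < suc m → (g : ℕ → ℕ) →
  sumRange (suc m) (g ∘ cycDist (suc m) c) ≡ sumRange (suc m) (g ∘ cycDist (suc m) 0)
sumRange-cycDist-rotate m c c<k g = begin
  sumRange k (λ y → f ∣ c - y ∣)                                ≡⟨ cong (λ z → sumRange z (λ y → f ∣ c - y ∣)) c+r≡k ⟨
  sumRange (c + r) (λ y → f ∣ c - y ∣)                          ≡⟨ sumRange-+ c r (λ y → f ∣ c - y ∣) ⟩
  sumRange c (λ y → f ∣ c - y ∣) + sumRange r (λ j → f ∣ c - (c + j) ∣)
    ≡⟨ cong₂ _+_ before-c (sumRange-cong r (λ j _ → cong f (∣m-m+n∣≡n c j))) ⟩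
  sumRange c (f ∘ suc) + sumRange r f                          ≡⟨ +-comm (sumRange c (f ∘ suc)) _ ⟩
  sumRange r f + sumRange c (f ∘ suc)                          ≡⟨ cong (sumRange r f +_) after-r ⟨
  sumRange r f + sumRange c (λ j → f (r + j))                  ≡⟨ sumRange-+ r c f ⟨
  sumRange (r + c) f                                           ≡⟨ cong (λ z → sumRange z f) (trans (+-comm r c) c+r≡k) ⟩
  sumRange k f                                                 ∎
  where
  open ≡-Reasoning
  k = suc m
  f : ℕ → ℕ
  f = g ∘ cycDist k 0
  r = k ∸ c
  c+r≡k : c + r ≡ k
  c+r≡k = m+[n∸m]≡n (<⇒≤ c<k)
  f-reflect : ∀ d → d ≤ k → f (k ∸ d) ≡ f d
  f-reflect d d≤k = cong g (trans (cong ((k ∸ d) ⊓_) (m∸[m∸n]≡n d≤k)) (⊓-comm (k ∸ d) d))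
  before-c : sumRange c (λ y → f ∣ c - y ∣) ≡ sumRange c (f ∘ suc)
  before-c = trans (sumRange-reverse c _) (sumRange-cong c (λ j j<c → cong f
               (trans (m≤n⇒∣n-m∣≡n∸m (m∸n≤m c (suc j))) (m∸[m∸n]≡n j<c))))
  after-r : sumRange c (λ j → f (r + j)) ≡ sumRange c (f ∘ suc)
  after-r = trans (sumRange-reverse c _) (sumRange-cong c λ j j<c →
    trans (sym (f-reflect (r + (c ∸ suc j)) (r+c-j≤k j)))
          (cong f (trans (sym (∸-+-assoc k r (c ∸ suc j)))
                  (trans (cong (_∸ (c ∸ suc j)) (m∸[m∸n]≡n (<⇒≤ c<k))) (m∸[m∸n]≡n j<c)))))
    where
    r+c-j≤k : ∀ j → r + (c ∸ suc j) ≤ k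
    r+c-j≤k j = ≤-trans (+-monoʳ-≤ r (m∸n≤m c (suc j))) (≤-reflexive (trans (+-comm r c) c+r≡k))

cycle-row : ∀ m (c : Fin (suc m)) (φ : ℕ → ℕ) →
  ∑[ b < m ] φ (cycDist (suc m) (toℕ c) (toℕ (punchIn c b))) ≡ sumRange m (λ j → φ (cycDist (suc m) 0 (suc j)))
cycle-row m c φ = +-cancelˡ-≡ (φ 0) _ _ (begin
  φ 0 + ∑[ b < m ] row (punchIn c b)       ≡⟨ cong (λ z → φ z + ∑[ b < m ] row (punchIn c b)) (cycDist-self (suc m) (toℕ c)) ⟨
  row c + ∑[ b < m ] row (punchIn c b)     ≡⟨ sum-remove {i = c} row ⟨
  sum row                                  ≡⟨ sum-toℕ (suc m) (φ ∘ cycDist (suc m) (toℕ c)) ⟩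
  sumRange (suc m) (φ ∘ cycDist (suc m) (toℕ c))
                                           ≡⟨ sumRange-cycDist-rotate m (toℕ c) (toℕ<n c) φ ⟩
  φ 0 + sumRange m (λ j → φ (cycDist (suc m) 0 (suc j))) ∎)
  where
  open ≡-Reasoning
  row : Fin (suc m) → ℕ
  row y = φ (cycDist (suc m) (toℕ c) (toℕ y))

-- Lollipops

-- m ∸ height j is the distance from j to the end m of the path in lollipop (suc m).
height : ℕ → ℕ
height zero = 1
height (suc j) = suc j

height≤ : ∀ {j M} → j < M → height j ≤ M
height≤ {zero} j<M = j<M
height≤ {suc j} j<M = <⇒≤ j<M

height-mono : ∀ {i j} → i ≤ j → height i ≤ height j
height-mono {zero} {zero} _ = ≤-refl
height-mono {zero} {suc j} _ = s≤s z≤n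
height-mono {suc i} {suc j} i≤j = i≤j

lolliEdge-height : ∀ i j → lolliEdge i j ≡ true → height j ≤ suc (height i) × height i ≤ suc (height j)
lolliEdge-height zero (suc zero) _ = s≤s z≤n , s≤s z≤n
lolliEdge-height zero (suc (suc zero)) _ = ≤-refl , s≤s z≤n
lolliEdge-height (suc zero) (suc (suc zero)) _ = ≤-refl , s≤s z≤n
lolliEdge-height (suc (suc i)) j e rewrite sym (≡ᵇ-true⇒≡ {3 + i} {j} e) = ≤-refl , m≤n⇒m≤1+n (n≤1+n _)

lollipop-sym : ∀ k (x y : Fin k) → lollipop k x y ≡ lollipop k y x
lollipop-sym k x y = ∨-comm (lolliEdge (toℕ x) (toℕ y)) _

height-Lipschitz : ∀ k → Lipschitz (lollipop k) (height ∘ toℕ)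
height-Lipschitz k x y e with ∨-elim (lolliEdge (toℕ x) (toℕ y)) e
... | inj₁ exy = proj₁ (lolliEdge-height _ _ exy)
... | inj₂ eyx = proj₂ (lolliEdge-height _ _ eyx)

indicator : Bool → ℕ
indicator b = if b then 1 else 0

length-filter : ∀ {n} (G : Adj n) x (ws : List (Fin n)) →
  length (filter (λ w → G x w Bool.≟ true) ws) ≡ ListAction.sum (map (indicator ∘ G x) ws)
length-filter G x [] = refl
length-filter G x (w ∷ ws) with G x w
... | true = cong suc (length-filter G x ws)
... | false = length-filter G x ws

degree≡sum : ∀ {n} (G : Adj n) x → degree G x ≡ ∑[ w < n ] indicator (G x w)
degree≡sum {n} G x = trans (length-filter G x (allFin n)) (sum-allFin n _)

degree≤1 : ∀ {n} (G : Adj n) x w₀ → (∀ w → G x w ≡ true → w ≡ w₀) → degree G x ≤ 1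
degree≤1 {suc n} G x w₀ unique rewrite degree≡sum G x | sum-remove {i = w₀} (indicator ∘ G x) =
  ≤-trans (+-monoʳ-≤ _ (≤-reflexive (trans (sum-cong-≗ {n} others-0) (sum-replicate-zero n))))
          (≤-trans (≤-reflexive (+-identityʳ _)) (indicator≤1 (G x w₀)))
  where
  indicator≤1 : ∀ b → indicator b ≤ 1
  indicator≤1 true = ≤-refl
  indicator≤1 false = z≤n
  others-0 : ∀ j → indicator (G x (punchIn w₀ j)) ≡ 0
  others-0 j with G x (punchIn w₀ j) in e
  ... | true = contradiction (unique _ e) (punchInᵢ≢i w₀ j)
  ... | false = refl

2≤degree : ∀ {n} (G : Adj n) x {w₁ w₂} → ¬ w₁ ≡ w₂ → G x w₁ ≡ true → G x w₂ ≡ true → 2 ≤ degree G x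
2≤degree {suc (suc n)} G x {w₁} {w₂} w₁≢w₂ e₁ e₂
  rewrite degree≡sum G x | sum-remove {i = w₁} (indicator ∘ G x)
        | sum-remove {i = punchOut w₁≢w₂} (indicator ∘ G x ∘ punchIn w₁)
        | punchIn-punchOut w₁≢w₂ | e₁ | e₂ = s≤s (s≤s z≤n)
2≤degree {suc zero} G x {zero} {zero} w₁≢w₂ _ _ = contradiction refl w₁≢w₂

lolliEdge-suc : ∀ i → lolliEdge i (suc i) ≡ true
lolliEdge-suc zero = refl
lolliEdge-suc (suc zero) = refl
lolliEdge-suc (suc (suc i)) = ≡ᵇ-refl i

lolliEdge-into-≥3 : ∀ i j → lolliEdge i (3 + j) ≡ true → suc i ≡ 3 + j
lolliEdge-into-≥3 (suc (suc i)) j e = ≡ᵇ-true⇒≡ e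

module _ {k} (x : Fin k) where

  lollipop-up : ∀ {j} (j<k : j < k) → lolliEdge (toℕ x) j ≡ true → lollipop k x (fromℕ< j<k) ≡ true
  lollipop-up j<k e = ∨-introˡ _ (subst (λ z → lolliEdge (toℕ x) z ≡ true) (sym (toℕ-fromℕ< j<k)) e)

  lollipop-down : ∀ {j} (j<k : j < k) → lolliEdge j (toℕ x) ≡ true → lollipop k x (fromℕ< j<k) ≡ true
  lollipop-down j<k e = ∨-introʳ (lolliEdge (toℕ x) (toℕ (fromℕ< j<k)))
                                 (subst (λ z → lolliEdge z (toℕ x) ≡ true) (sym (toℕ-fromℕ< j<k)) e)

fromℕ<-≢ : ∀ {k i j} (i<k : i < k) (j<k : j < k) → ¬ i ≡ j → ¬ fromℕ< i<k ≡ fromℕ< j<k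
fromℕ<-≢ i<k j<k i≢j eq = i≢j (trans (sym (toℕ-fromℕ< i<k)) (trans (cong toℕ eq) (toℕ-fromℕ< j<k)))

2≤degree-lollipop : ∀ {k} (x : Fin k) → 3 ≤ k → suc (toℕ x) < k → 2 ≤ degree (lollipop k) x
2≤degree-lollipop {k} x 3≤k x+1<k = neighbours (toℕ x) refl
  where
  neighbours : ∀ i → toℕ x ≡ i → 2 ≤ degree (lollipop k) x
  neighbours zero x≡0 = 2≤degree (lollipop k) x (fromℕ<-≢ 1<k 3≤k (λ ()))
    (lollipop-up x 1<k (subst (λ i → lolliEdge i 1 ≡ true) (sym x≡0) refl))
    (lollipop-up x 3≤k (subst (λ i → lolliEdge i 2 ≡ true) (sym x≡0) refl))
    where
    1<k : 1 < k
    1<k = ≤-trans (s≤s (s≤s z≤n)) 3≤k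
  neighbours (suc j) x≡1+j = 2≤degree (lollipop k) x
    (fromℕ<-≢ j<k j+2<k (λ j≡j+2 → <-irrefl j≡j+2 (<-trans (n<1+n j) (n<1+n (suc j)))))
    (lollipop-down x j<k (subst (λ i → lolliEdge j i ≡ true) (sym x≡1+j) (lolliEdge-suc j)))
    (lollipop-up x j+2<k (subst (λ i → lolliEdge i (suc (suc j)) ≡ true) (sym x≡1+j) (lolliEdge-suc (suc j))))
    where
    j+2<k : suc (suc j) < k
    j+2<k = subst (λ i → suc i < k) x≡1+j x+1<k
    j<k : j < k
    j<k = <-trans (n<1+n j) (<-trans (n<1+n (suc j)) j+2<k)

degree-lollipop-end : ∀ m → 3 ≤ m → degree (lollipop (suc m)) (fromℕ m) ≤ 1
degree-lollipop-end (suc (suc (suc m₃))) (s≤s (s≤s (s≤s z≤n))) = degree≤1 (lollipop (4 + m₃)) (fromℕ (3 + m₃)) w₀ only-w₀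
  where
  m-1<k : 2 + m₃ < 4 + m₃
  m-1<k = m≤n⇒m≤1+n (n<1+n _)
  w₀ = fromℕ< m-1<k
  only-w₀ : ∀ y → lollipop (4 + m₃) (fromℕ (3 + m₃)) y ≡ true → y ≡ w₀
  only-w₀ y e with ∨-elim (lolliEdge (3 + m₃) (toℕ y))
                    (subst (λ i → lolliEdge i (toℕ y) ∨ lolliEdge (toℕ y) i ≡ true) (toℕ-fromℕ (3 + m₃)) e)
  ... | inj₁ e-out = contradiction (toℕ<n y) (λ y<k → <-irrefl (sym (≡ᵇ-true⇒≡ e-out)) y<k)
  ... | inj₂ e-in = toℕ-injective (trans (suc-injective (lolliEdge-into-≥3 (toℕ y) m₃ e-in)) (sym (toℕ-fromℕ< m-1<k)))

lollipop-minDegree : ∀ m → 3 ≤ m → (ℓ : Fin (suc m)) → IsMinDegree (lollipop (suc m)) ℓ → toℕ ℓ ≡ m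
lollipop-minDegree m 3≤m ℓ ℓ-min with toℕ ℓ Data.Nat.≟ m
... | yes ℓ≡m = ℓ≡m
... | no ℓ≢m = contradiction (≤-trans 2≤degree-ℓ (≤-trans (ℓ-min (fromℕ m)) (degree-lollipop-end m 3≤m))) (<-irrefl refl)
  where
  2≤degree-ℓ = 2≤degree-lollipop ℓ (m≤n⇒m≤1+n 3≤m) (s≤s (≤∧≢⇒< (≤-pred (toℕ<n ℓ)) ℓ≢m))

-- A lower bound for distances in a lollipop: distinct vertices are at distance at least 1, and height is 1-Lipschitz.
lollipopBound : ℕ → ℕ → ℕ
lollipopBound x y = ∣ height x - height y ∣ ⊔ 1

lollipopBound-comm : ∀ x y → lollipopBound x y ≡ lollipopBound y x
lollipopBound-comm x y rewrite ∣-∣-comm (height x) (height y) = refl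

cycDist-last : ∀ m₁ → cycDist (2 + m₁) 0 (suc m₁) ≡ 1
cycDist-last m₁ rewrite m+n∸n≡m 1 m₁ | ⊓-zeroʳ m₁ = refl

-- Off the first row the cycle distance is at most y ∸ x = lollipopBound x y; the first row is compared as a whole.
pairSum-cycDist≤lollipopBound : ∀ k → 2 ≤ k →
  pairSum (λ (x y : Fin k) → cycDist k (toℕ x) (toℕ y)) ≤ pairSum (λ (x y : Fin k) → lollipopBound (toℕ x) (toℕ y))
pairSum-cycDist≤lollipopBound k@(suc (suc m₁)) (s≤s (s≤s z≤n))
  rewrite pairSum-toℕ k (cycDist k) | pairSum-toℕ k lollipopBound =
  +-mono-≤ first-row (sumRange-mono-≤ (suc m₁) (λ x _ → sumRange-mono-≤ k (λ y _ → later-rows x y)))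
  where
  later-rows : ∀ x y → (if suc x <ᵇ y then cycDist k (suc x) y else 0) ≤ (if suc x <ᵇ y then lollipopBound (suc x) y else 0)
  later-rows x zero = z≤n
  later-rows x (suc y) with x <ᵇ y
  ... | true = ≤-trans (m⊓n≤m _ _) (m≤m⊔n _ 1)
  ... | false = z≤n
  first-row : sumRange (suc m₁) (λ j → cycDist k 0 (suc j)) ≤ sumRange (suc m₁) (λ j → j ⊔ 1)
  first-row = begin
    sumRange (suc m₁) (λ j → cycDist k 0 (suc j))     ≡⟨ sumRange-snoc m₁ _ ⟩
    sumRange m₁ (λ j → cycDist k 0 (suc j)) + cycDist k 0 (suc m₁)
                                                      ≤⟨ +-mono-≤ (sumRange-mono-≤ m₁ (λ j _ → m⊓n≤m (suc j) _)) (≤-reflexive (cycDist-last m₁)) ⟩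
    sumRange m₁ suc + 1                               ≡⟨ +-comm _ 1 ⟩
    1 + sumRange m₁ suc                               ≡⟨ cong (1 +_) (sumRange-cong m₁ (λ j _ → cong suc (sym (⊔-identityʳ j)))) ⟩
    sumRange (suc m₁) (λ j → j ⊔ 1)                   ∎
    where open ≤-Reasoning

-- Going round the cycle, the distances are at most 1, 2, …, m₁ and then 1; the distances from the end of the
-- lollipop, read from its end, are exactly 1, 2, …, m₁ and then m₁.
module _ (m₁ : ℕ) (φ : ℕ → ℕ) (φ-mono : ∀ {a b} → a ≤ b → φ a ≤ φ b) where

  private
    m = suc m₁

    cycle-prefix lollipop-prefix : ℕ
    cycle-prefix = sumRange m₁ (λ j → φ (cycDist (suc m) 0 (suc j)))
    lollipop-prefix = sumRange m₁ (λ j → φ (m ∸ height (m ∸ suc j)))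

    cycle-split : sumRange m (λ j → φ (cycDist (suc m) 0 (suc j))) ≡ cycle-prefix + φ 1
    cycle-split = trans (sumRange-snoc m₁ _) (cong (λ z → cycle-prefix + φ z) (cycDist-last m₁))

    lollipop-split : sumRange m (λ j → φ (m ∸ height j)) ≡ lollipop-prefix + φ m₁
    lollipop-split = trans (sumRange-reverse m (λ j → φ (m ∸ height j))) (trans (sumRange-snoc m₁ _)
                       (cong (λ z → lollipop-prefix + φ (m ∸ height z)) (n∸n≡0 m₁)))

    cycDist≤ : ∀ j → suc j < m → cycDist (suc m) 0 (suc j) ≤ m ∸ height (m ∸ suc j)
    cycDist≤ j j+1<m with m ∸ suc j in eq
    ... | zero = contradiction (m∸n≡0⇒m≤n eq) (<⇒≱ j+1<m)
    ... | suc i = ≤-trans (m⊓n≤m (suc j) _) (≤-reflexive (sym (begin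
          m ∸ suc i          ≡⟨ cong (m ∸_) eq ⟨
          m ∸ (m ∸ suc j)    ≡⟨ m∸[m∸n]≡n (<⇒≤ j+1<m) ⟩
          suc j              ∎)))
      where open ≡-Reasoning

    prefix≤ : cycle-prefix ≤ lollipop-prefix
    prefix≤ = sumRange-mono-≤ m₁ (λ j j<m₁ → φ-mono (cycDist≤ j (s≤s j<m₁)))

  cycle-row≤lollipop-row : 1 ≤ m₁ →
    sumRange m (λ j → φ (cycDist (suc m) 0 (suc j))) ≤ sumRange m (λ j → φ (m ∸ height j))
  cycle-row≤lollipop-row 1≤m₁ = subst₂ _≤_ (sym cycle-split) (sym lollipop-split) (+-mono-≤ prefix≤ (φ-mono 1≤m₁))

  cycle-row<lollipop-row : φ 1 < φ m₁ →
    sumRange m (λ j → φ (cycDist (suc m) 0 (suc j))) < sumRange m (λ j → φ (m ∸ height j))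
  cycle-row<lollipop-row φ1<φm₁ = subst₂ _<_ (sym cycle-split) (sym lollipop-split) (+-mono-≤-< prefix≤ φ1<φm₁)

-- Gluing a complete graph

Complete : ∀ {k} → Adj k → Set
Complete {k} K = ∀ (x y : Fin k) → ¬ x ≡ y → K x y ≡ true

module _ {n m} (H : Adj n) (v : Fin n) {K : Adj (suc m)} {u : Fin (suc m)} (K-complete : Complete K) where

  open Glue H v K u

  dist-inK-complete : ∀ {a b} → ¬ a ≡ b → dist G (inK a) (inK b) ≡ 1
  dist-inK-complete {a} {b} a≢b = ≤-antisym
    (dist-inK≤ a b ([] ∷ʳ K-complete _ _ (a≢b ∘ punchIn-injective u a b)))
    (1≤dist-inK a≢b)

  dist-inH-inK-complete : ∀ i b → dist G (inH i) (inK b) ≡ (distAux H i v 0 N + 1) ⊓ N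
  dist-inH-inK-complete i b rewrite sym (dist-inH i v) = ≤-antisym
    (dist-inH-inK≤ i b ([] ∷ʳ K-complete u (punchIn u b) (λ u≡pb → punchInᵢ≢i u b (sym u≡pb))))
    (subst (λ s → (d i + s) ⊓ N ≤ dist G (inH i) (inK b)) (t-punchIn b) (≤dist-inH-inK t-lip t-u i b))
    where
    t : Fin (suc m) → ℕ
    t y = if ⌊ u ≟ y ⌋ then 0 else 1
    t≤1 : ∀ y → t y ≤ 1
    t≤1 y with u ≟ y
    ... | yes _ = z≤n
    ... | no _ = ≤-refl
    t-lip : Lipschitz K t
    t-lip x y _ = ≤-trans (t≤1 y) (s≤s z≤n)
    t-u : t u ≡ 0
    t-u rewrite ⌊≟⌋-refl u = refl
    t-punchIn : ∀ b → t (punchIn u b) ≡ 1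
    t-punchIn b with u ≟ punchIn u b
    ... | yes u≡pb = contradiction (sym u≡pb) (punchInᵢ≢i u b)
    ... | no _ = refl

W-glue-complete : ∀ {n m} (H : Adj n) (v : Fin n) {K K′ : Adj (suc m)} (u u′ : Fin (suc m)) →
                  Complete K → Complete K′ → W (glue H v K u) ≡ W (glue H v K′ u′)
W-glue-complete {n} {m} H v {K} {K′} u u′ K-complete K′-complete = begin
  W A.G                                                     ≡⟨ A.W-glue ⟩
  A.Hpart + ∑[ i < n ] A.row i + A.Kpairs
    ≡⟨ cong₂ _+_ (cong₂ _+_ (trans A.Hpart≡ (sym B.Hpart≡)) (sum-cong-≗ {n} rows)) (sum-cong-≗ {m} inner) ⟩
  B.Hpart + ∑[ i < n ] B.row i + B.Kpairs                   ≡⟨ B.W-glue ⟨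
  W B.G                                                     ∎
  where
  open ≡-Reasoning
  module A = Glue H v K u
  module B = Glue H v K′ u′
  rows : ∀ i → A.row i ≡ B.row i
  rows i = sum-cong-≗ {m} λ b → trans (dist-inH-inK-complete H v K-complete i b)
                                      (sym (dist-inH-inK-complete H v K′-complete i b))
  pointwise : ∀ a b → dist A.G (A.inK a) (A.inK b) ≡ dist B.G (B.inK a) (B.inK b)
  pointwise a b with a ≟ b
  ... | yes refl = trans (dist-refl (A.inK a)) (sym (dist-refl (B.inK a)))
  ... | no a≢b = trans (dist-inK-complete H v K-complete a≢b) (sym (dist-inK-complete H v K′-complete a≢b))
  inner : ∀ a → ∑[ b < m ] upper (λ x y → dist A.G (A.inK x) (A.inK y)) a b
              ≡ ∑[ b < m ] upper (λ x y → dist B.G (B.inK x) (B.inK y)) a b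
  inner a = sum-cong-≗ {m} λ b → cong (if toℕ a <ᵇ toℕ b then_else 0) (pointwise a b)

cycle-3-complete : Complete (cycle 3)
cycle-3-complete zero zero 0≢0 = contradiction refl 0≢0
cycle-3-complete zero (suc zero) _ = refl
cycle-3-complete zero (suc (suc zero)) _ = refl
cycle-3-complete (suc zero) zero _ = refl
cycle-3-complete (suc zero) (suc zero) 1≢1 = contradiction refl 1≢1
cycle-3-complete (suc zero) (suc (suc zero)) _ = refl
cycle-3-complete (suc (suc zero)) zero _ = refl
cycle-3-complete (suc (suc zero)) (suc zero) _ = refl
cycle-3-complete (suc (suc zero)) (suc (suc zero)) 2≢2 = contradiction refl 2≢2

lollipop-3-complete : Complete (lollipop 3)
lollipop-3-complete zero zero 0≢0 = contradiction refl 0≢0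
lollipop-3-complete zero (suc zero) _ = refl
lollipop-3-complete zero (suc (suc zero)) _ = refl
lollipop-3-complete (suc zero) zero _ = refl
lollipop-3-complete (suc zero) (suc zero) 1≢1 = contradiction refl 1≢1
lollipop-3-complete (suc zero) (suc (suc zero)) _ = refl
lollipop-3-complete (suc (suc zero)) zero _ = refl
lollipop-3-complete (suc (suc zero)) (suc zero) _ = refl
lollipop-3-complete (suc (suc zero)) (suc (suc zero)) 2≢2 = contradiction refl 2≢2

-- Cycle against lollipop for k ≥ 4

∃-neighbour : ∀ {n} (H : Adj n) → IsSimple H → Connected H → HasEdge H → ∀ v → ∃[ i ] (¬ i ≡ v × H i v ≡ true)
∃-neighbour H (H-sym , H-loopless) H-connected (a , b , a~b) v = first-step (H-connected v z) v≢z
  where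
  irreflexive : ∀ {x y} → H x y ≡ true → ¬ x ≡ y
  irreflexive {x} x~y refl with trans (sym (H-loopless x)) x~y
  ... | ()
  other-end : ∃[ z ] ¬ v ≡ z
  other-end with a ≟ v
  ... | yes refl = b , irreflexive a~b
  ... | no a≢v = a , a≢v ∘ sym
  z = proj₁ other-end
  v≢z = proj₂ other-end
  first-step : ∀ {z} → Walk H v z → ¬ v ≡ z → ∃[ i ] (¬ i ≡ v × H i v ≡ true)
  first-step here v≢v = contradiction refl v≢v
  first-step (step {x = x} v~x _) _ = x , irreflexive v~x ∘ sym , trans (H-sym x v) v~x

W-glue-split : ∀ {n m} (H : Adj (suc n)) (v : Fin (suc n)) (K : Adj (suc m)) (u : Fin (suc m)) →
               let open Glue H v K u in W G ≡ Hpart + ∑[ j < n ] row (punchIn v j) + Kpart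
W-glue-split {n} H v K u = trans W-glue (trans (cong (λ z → Hpart + z + Kpairs) (sum-remove {i = v} row))
                                                (rearrange Hpart (row v) (∑[ j < n ] row (punchIn v j)) Kpairs))
  where
  open Glue H v K u
  rearrange : ∀ h r s q → h + (r + s) + q ≡ h + s + (r + q)
  rearrange = solve-∀

module _ {n m₃ : ℕ} (H : Adj (suc n)) (v : Fin (suc n)) (c ℓ : Fin (4 + m₃)) (ℓ-end : toℕ ℓ ≡ 3 + m₃) where

  private
    m₁ m k N : ℕ
    m₁ = 2 + m₃
    m = suc m₁
    k = suc m
    N = suc n + m
    module A = Glue H v (cycle k) c
    module B = Glue H v (lollipop k) ℓ

  toℕ-punchIn-ℓ : ∀ b → toℕ (punchIn ℓ b) ≡ toℕ b
  toℕ-punchIn-ℓ b = toℕ-punchIn-< ℓ b (subst (toℕ b <_) (sym ℓ-end) (toℕ<n b))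

  t : Fin k → ℕ
  t y = m ∸ height (toℕ y)

  t-Lipschitz : Lipschitz (lollipop k) t
  t-Lipschitz = Lipschitz-∸ (lollipop-sym k) (height-Lipschitz k) m

  t-ℓ : t ℓ ≡ 0
  t-ℓ rewrite ℓ-end = n∸n≡0 m

  m≤N : m ≤ N
  m≤N = m≤n+m m (suc n)

  ⊓N-elim : ∀ {x d} → x ≤ N → x ⊓ N ≤ d → x ≤ d
  ⊓N-elim x≤N = subst (_≤ _) (m≤n⇒m⊓n≡m x≤N)

  lollipop-row≥ : ∀ i b → (B.d i + (m ∸ height (toℕ b))) ⊓ N ≤ dist B.G (B.inH i) (B.inK b)
  lollipop-row≥ i b = subst (λ j → (B.d i + (m ∸ height j)) ⊓ N ≤ dist B.G (B.inH i) (B.inK b))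
                            (toℕ-punchIn-ℓ b) (B.≤dist-inH-inK t-Lipschitz t-ℓ i b)

  height-gap≤ : ∀ a b → (height (toℕ b) ∸ height (toℕ a)) ⊓ N ≤ dist B.G (B.inK a) (B.inK b)
  height-gap≤ a b = subst₂ (λ i j → (height j ∸ height i) ⊓ N ≤ dist B.G (B.inK a) (B.inK b))
                           (toℕ-punchIn-ℓ a) (toℕ-punchIn-ℓ b) (B.Lipschitz⇒≤dist-inK (height-Lipschitz k) a b)

  Kpart≤ : A.Kpart ≤ B.Kpart
  Kpart≤ = begin
    A.Kpart       ≤⟨ A.Kpart≤pairSum cyc (λ x y → cycDist-comm k (toℕ x) (toℕ y))
                       (λ b → A.dist-inHv-inK≤ b (cycle-Reach m c (punchIn c b)))
                       (λ a b → A.dist-inK≤ a b (cycle-Reach m (punchIn c a) (punchIn c b))) ⟩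
    pairSum cyc   ≤⟨ pairSum-cycDist≤lollipopBound k (s≤s (s≤s z≤n)) ⟩
    pairSum bound ≤⟨ B.pairSum≤Kpart bound (λ x y → lollipopBound-comm (toℕ x) (toℕ y)) end-row inner ⟩
    B.Kpart       ∎
    where
    open ≤-Reasoning
    cyc bound : Fin k → Fin k → ℕ
    cyc x y = cycDist k (toℕ x) (toℕ y)
    bound x y = lollipopBound (toℕ x) (toℕ y)
    end-row : ∀ b → bound ℓ (punchIn ℓ b) ≤ dist B.G (B.inH v) (B.inK b)
    end-row b rewrite ℓ-end | toℕ-punchIn-ℓ b = ⊔-lub
      (subst (_≤ dist B.G (B.inH v) (B.inK b)) (sym (m≤n⇒∣n-m∣≡n∸m (height≤ (toℕ<n b))))
        (⊓N-elim (≤-trans (m∸n≤m m (height (toℕ b))) m≤N)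
          (subst (λ z → (z + (m ∸ height (toℕ b))) ⊓ N ≤ dist B.G (B.inH v) (B.inK b)) B.d-v (lollipop-row≥ v b))))
      (B.1≤dist-inH-inK v b)
    inner : ∀ a b → toℕ a < toℕ b → bound (punchIn ℓ a) (punchIn ℓ b) ≤ dist B.G (B.inK a) (B.inK b)
    inner a b a<b rewrite toℕ-punchIn-ℓ a | toℕ-punchIn-ℓ b = ⊔-lub
      (subst (_≤ dist B.G (B.inK a) (B.inK b)) (sym (m≤n⇒∣m-n∣≡n∸m (height-mono (<⇒≤ a<b))))
        (⊓N-elim (≤-trans (m∸n≤m (height (toℕ b)) (height (toℕ a))) (≤-trans (height≤ (toℕ<n b)) m≤N))
                 (height-gap≤ a b)))
      (B.1≤dist-inK (λ a≡b → <-irrefl (cong toℕ a≡b) a<b))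

  dH : Fin (suc n) → ℕ
  dH i = distAux H i v 0 N

  φ : Fin (suc n) → ℕ → ℕ
  φ i s = (dH i + s) ⊓ N

  φ-mono : ∀ i {a b} → a ≤ b → φ i a ≤ φ i b
  φ-mono i a≤b = ⊓-monoˡ-≤ N (+-monoʳ-≤ (dH i) a≤b)

  rowA≤ : ∀ i → A.row i ≤ sumRange m (λ j → φ i (cycDist k 0 (suc j)))
  rowA≤ i = ≤-trans
    (sum-mono-≤ λ b → subst (λ z → dist A.G (A.inH i) (A.inK b) ≤ (z + _) ⊓ N) (A.dist-inH i v)
                        (A.dist-inH-inK≤ i b (cycle-Reach m c (punchIn c b))))
    (≤-reflexive (cycle-row m c (φ i)))

  ≤rowB : ∀ i → sumRange m (λ j → φ i (m ∸ height j)) ≤ B.row i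
  ≤rowB i = ≤-trans (≤-reflexive (sym (sum-toℕ m (λ j → φ i (m ∸ height j)))))
    (sum-mono-≤ λ b → subst (λ z → (z + (m ∸ height (toℕ b))) ⊓ N ≤ dist B.G (B.inH i) (B.inK b))
                        (B.dist-inH i v) (lollipop-row≥ i b))

  row≤ : ∀ i → A.row i ≤ B.row i
  row≤ i = ≤-trans (rowA≤ i) (≤-trans (cycle-row≤lollipop-row m₁ (φ i) (φ-mono i) (s≤s z≤n)) (≤rowB i))

  row< : ∀ i → dH i ≡ 1 → A.row i < B.row i
  row< i dHi≡1 = <-≤-trans (≤-<-trans (rowA≤ i) (cycle-row<lollipop-row m₁ (φ i) (φ-mono i) φ1<φm₁)) (≤rowB i)
    where
    φ1<φm₁ : φ i 1 < φ i m₁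
    φ1<φm₁ rewrite dHi≡1 = ≤-<-trans (m⊓n≤m 2 N) (<-≤-trans (s≤s (s≤s (s≤s z≤n))) (⊓-glb ≤-refl m≤N))

  dH-neighbour : ∀ {i} → ¬ i ≡ v → H i v ≡ true → dH i ≡ 1
  dH-neighbour {i} i≢v i~v = trans (sym (A.dist-inH i v))
    (≤-antisym (dist≤ {G = A.G} ([] ∷ʳ trans (A.glue-HH i v) i~v)) (1≤dist (i≢v ∘ ↑ˡ-injective m i v)))

  W-cycle<W-lollipop : ∀ {i} → ¬ i ≡ v → H i v ≡ true → W A.G < W B.G
  W-cycle<W-lollipop {i} i≢v i~v = begin-strict
    W A.G                                                ≡⟨ W-glue-split H v (cycle k) c ⟩
    A.Hpart + ∑[ j < n ] A.row (punchIn v j) + A.Kpart  <⟨ +-mono-<-≤ (+-mono-≤-< (≤-reflexive Hpart≡) other-rows<) Kpart≤ ⟩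
    B.Hpart + ∑[ j < n ] B.row (punchIn v j) + B.Kpart  ≡⟨ W-glue-split H v (lollipop k) ℓ ⟨
    W B.G                                                ∎
    where
    open ≤-Reasoning
    Hpart≡ : A.Hpart ≡ B.Hpart
    Hpart≡ = trans A.Hpart≡ (sym B.Hpart≡)
    j₀ = punchOut (i≢v ∘ sym)
    other-rows< : ∑[ j < n ] A.row (punchIn v j) < ∑[ j < n ] B.row (punchIn v j)
    other-rows< = sum-mono-< j₀ (row≤ ∘ punchIn v)
      (subst (λ z → A.row z < B.row z) (sym (punchIn-punchOut (i≢v ∘ sym))) (row< i (dH-neighbour i≢v i~v)))

lemma3p10 : ∀ {n} (H : Adj n) → IsSimple H → Connected H → HasEdge H → (v : Fin n)
          → (k : ℕ) → 3 ≤ k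
          → (c : Fin k) → (ℓ : Fin k) → IsMinDegree (lollipop k) ℓ
          → (W (glue H v (cycle k) c) ≤ W (glue H v (lollipop k) ℓ))
            × ((W (glue H v (cycle k) c) ≡ W (glue H v (lollipop k) ℓ)) ⇔ (k ≡ 3))
lemma3p10 {zero} _ _ _ _ ()
lemma3p10 _ _ _ _ _ 1 (s≤s ())
lemma3p10 _ _ _ _ _ 2 (s≤s (s≤s ()))
lemma3p10 H _ _ _ v 3 _ c ℓ _ = ≤-reflexive W≡ , mk⇔ (λ _ → refl) (λ _ → W≡)
  where
  W≡ = W-glue-complete H v c ℓ cycle-3-complete lollipop-3-complete
lemma3p10 {suc n} H simple connected has-edge v k@(suc (suc (suc (suc m₃)))) _ c ℓ ℓ-min =
  <⇒≤ W< , mk⇔ (λ W≡ → contradiction W≡ (<⇒≢ W<)) (λ ())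
  where
  ℓ-end = lollipop-minDegree (3 + m₃) (s≤s (s≤s (s≤s z≤n))) ℓ ℓ-min
  i₀ = ∃-neighbour H simple connected has-edge v
  W< = W-cycle<W-lollipop H v c ℓ ℓ-end (proj₁ (proj₂ i₀)) (proj₂ (proj₂ i₀))
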